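{- Let $n\ge 2$ be even, let $a,b\in\mathbb{C}$ with $b\neq 0$, let $A^{\dagger}$ be the $n\times n$ tridiagonal matrix with $A^{\dagger}_{ii}=a$, $A^{\dagger}_{i,i+1}=A^{\dagger}_{i+1,i}=(-1)^{i+1}b$ for $1\le i\le n-1$ and all other entries $0$, let $\tilde{J}$ be the $n\times n$ exchange matrix ($\tilde{J}_{i,j}=1$ if $i+j=n+1$ and $0$ otherwise), and let $\tilde{A}^{\dagger}=A^{\dagger}\tilde{J}$ be the anti-tridiagonal matrix obtained from $A^{\dagger}$ by reversing the order of its columns. Then for every positive integer $s$, $$(\tilde{A}^{\dagger})^s=\begin{cases}(A^{\dagger})^s, & s \text{ even},\\ \tilde{J}(A^{\dagger})^s, & s\text{ odd}.\end{cases}$$ -}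

module Defs where

open import Level using (Level)
open import Algebra.Bundles using (CommutativeRing)
open import Data.Nat using (ℕ; zero; suc)
import Data.Nat as ℕ
open import Data.Fin using (Fin; toℕ)
import Data.Fin as F
open import Relation.Nullary using (yes; no)

module Mat {c ℓ : Level} (R : CommutativeRing c ℓ) where
  open CommutativeRing R

  Matrix : ℕ → Set c
  Matrix n = Fin n → Fin n → Carrier

  ∑ : ∀ {n} → (Fin n → Carrier) → Carrier
  ∑ {zero}  f = 0#
  ∑ {suc n} f = f F.zero + ∑ (λ i → f (F.suc i))

  _⊗_ : ∀ {n} → Matrix n → Matrix n → Matrix n
  (M ⊗ N) i j = ∑ (λ k → M i k * N k j)

  I : ∀ {n} → Matrix n
  I i j with toℕ i ℕ.≟ toℕ j
  ... | yes _ = 1#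
  ... | no  _ = 0#

  _^_ : ∀ {n} → Matrix n → ℕ → Matrix n
  M ^ zero  = I
  M ^ suc s = M ⊗ (M ^ s)

  _≋_ : ∀ {n} → Matrix n → Matrix n → Set ℓ
  M ≋ N = ∀ i j → M i j ≈ N i j

  sgn : ℕ → Carrier
  sgn zero    = 1#
  sgn (suc k) = - sgn k

  -- A† with 0-based indices: A i i = a, A i (i+1) = A (i+1) i = (-1)^i b
  -- (i.e. (-1)^(i'+1) b for the 1-based index i' = i+1), other entries 0.
  Adag : ∀ n → Carrier → Carrier → Matrix n
  Adag n a b i j with toℕ i ℕ.≟ toℕ j
  ... | yes _ = a
  ... | no _ with toℕ j ℕ.≟ suc (toℕ i)
  ...   | yes _ = sgn (toℕ i) * b
  ...   | no _ with toℕ i ℕ.≟ suc (toℕ j)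
  ...     | yes _ = sgn (toℕ j) * b
  ...     | no _ = 0#

  -- exchange matrix: J i j = 1 iff i + j = n - 1 (0-based; i.e. i'+j' = n+1 1-based)
  Jex : ∀ n → Matrix n
  Jex n i j with toℕ i ℕ.+ toℕ j ℕ.≟ n ℕ.∸ 1
  ... | yes _ = 1#
  ... | no _ = 0#

  Atilde : ∀ n → Carrier → Carrier → Matrix n
  Atilde n a b = Adag n a b ⊗ Jex n

module Submission where

-- Write op for the reversal i ↦ n-1-i of Fin n, so that
-- (M J)ᵢⱼ = M i (op j) and (J M)ᵢⱼ = M (op i) j for the exchange matrix J.
-- A matrix P is persymmetric when P (op i) (op j) = P i j, i.e. J P J = P.
-- Persymmetric matrices are closed under products, hence under powers, and
-- for persymmetric P an induction on s gives
--     ((P J) ^ s) i j = (P ^ s) i (op applied s times to j),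
-- because one factor of J can always be moved through a persymmetric power.
-- Since op is an involution, this is P ^ s for even s and P ^ s J = J P ^ s
-- for odd s.  The only place where the shape of A† enters is its
-- persymmetry: reflecting (x, x+1) gives (m-x, m-x-1) with m = n-1, and the
-- signs (-1)^x and (-1)^(m-x-1) agree exactly because n is even.

open import Defs
open import Level using (Level)
open import Algebra.Bundles using (CommutativeRing)
open import Data.Nat using (ℕ; _≤_)
import Data.Nat as N
open import Data.Nat.Divisibility using (_∣_)
open import Data.Product using (_×_)
open import Relation.Nullary using (¬_)

open import Data.Nat using (zero; suc; _∸_)
import Data.Nat.Properties as NP
open import Data.Nat.Divisibility using (divides; ∣-refl; ∣m+n∣m⇒∣n)
open import Data.Fin using (Fin; toℕ; opposite)
import Data.Fin as F
open import Data.Fin.Properties using (toℕ-injective; suc-injective; opposite-prop; opposite-involutive; toℕ≤pred[n])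
import Data.Fin.Permutation as Perm
open import Data.Product using (_,_)
open import Data.Vec.Functional using (replicate)
open import Relation.Binary.PropositionalEquality
  using (_≡_; _≢_; refl; sym; trans; cong; subst; module ≡-Reasoning)
open import Relation.Nullary using (yes; no; contradiction)

data Band (x y : ℕ) : Set where
  diagonal : x ≡ y → Band x y
  above    : y ≡ suc x → Band x y
  below    : x ≡ suc y → Band x y
  outside  : x ≢ y → y ≢ suc x → x ≢ suc y → Band x y

band : ∀ x y → Band x y
band x y with x N.≟ y | y N.≟ suc x | x N.≟ suc y
... | yes x≡y | _        | _        = diagonal x≡y
... | no _    | yes y≡1+x | _       = above y≡1+x
... | no _    | no _     | yes x≡1+y = below x≡1+y
... | no x≢y  | no y≢1+x | no x≢1+y  = outside x≢y y≢1+x x≢1+y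

mirror-shift : ∀ {m x x' y y'} d → x N.+ x' ≡ m → y N.+ y' ≡ m → y ≡ d N.+ x → x' ≡ d N.+ y'
mirror-shift {x = x} {x'} {_} {y'} d hx hy refl = NP.+-cancelˡ-≡ x x' (d N.+ y') (begin
    x N.+ x'           ≡⟨ trans hx (sym hy) ⟩
    (d N.+ x) N.+ y'   ≡⟨ cong (N._+ y') (NP.+-comm d x) ⟩
    (x N.+ d) N.+ y'   ≡⟨ NP.+-assoc x d y' ⟩
    x N.+ (d N.+ y')   ∎)
  where open ≡-Reasoning

mirror-band : ∀ {m x x' y y'} → x N.+ x' ≡ m → y N.+ y' ≡ m → Band x y → Band x' y'
mirror-band hx hy (diagonal x≡y) = diagonal (mirror-shift 0 hx hy (sym x≡y))
mirror-band hx hy (above y≡1+x)  = below (mirror-shift 1 hx hy y≡1+x)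
mirror-band hx hy (below x≡1+y)  = above (mirror-shift 1 hy hx x≡1+y)
mirror-band {x = x} {x'} {y} {y'} hx hy (outside x≢y y≢1+x x≢1+y) =
  outside (λ e → x≢y (mirror-shift 0 hx′ hy′ (sym e)))
          (λ e → x≢1+y (mirror-shift 1 hx′ hy′ e))
          (λ e → y≢1+x (mirror-shift 1 hy′ hx′ e))
  where
    hx′ : x' N.+ x ≡ _
    hx′ = trans (NP.+-comm x' x) hx
    hy′ : y' N.+ y ≡ _
    hy′ = trans (NP.+-comm y' y) hy

opposite-sum : ∀ {n} (i : Fin n) → toℕ (opposite i) N.+ toℕ i ≡ n ∸ 1
opposite-sum {suc m} i = trans (cong (N._+ toℕ i) (opposite-prop i)) (NP.m∸n+n≡m (toℕ≤pred[n] i))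

opposite-injective : ∀ {n} {i j : Fin n} → opposite i ≡ opposite j → i ≡ j
opposite-injective {i = i} {j} e =
  trans (sym (opposite-involutive i)) (trans (cong opposite e) (opposite-involutive j))

opposite^ : ∀ {n} → ℕ → Fin n → Fin n
opposite^ zero    j = j
opposite^ (suc s) j = opposite (opposite^ s j)

opposite^-double : ∀ {n} k (j : Fin n) → opposite^ (2 N.* k) j ≡ j
opposite^-double zero    j = refl
opposite^-double (suc k) j =
  trans (cong (λ s → opposite^ s j) (NP.*-suc 2 k))
        (trans (opposite-involutive _) (opposite^-double k j))

opposite^-even : ∀ {n} k (j : Fin n) → opposite^ (2 N.* k N.+ 2) j ≡ j
opposite^-even k j =
  trans (cong (λ s → opposite^ s j) (NP.+-comm (2 N.* k) 2))
        (trans (opposite-involutive _) (opposite^-double k j))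

opposite^-odd : ∀ {n} k (j : Fin n) → opposite^ (2 N.* k N.+ 1) j ≡ opposite j
opposite^-odd k j =
  trans (cong (λ s → opposite^ s j) (NP.+-comm (2 N.* k) 1))
        (cong opposite (opposite^-double k j))

module Persymmetry {c ℓ : Level} (R : CommutativeRing c ℓ) where
  open CommutativeRing R hiding (refl; sym; trans)
  open CommutativeRing R using () renaming (refl to ≈-refl; sym to ≈-sym; trans to ≈-trans)
  open Mat R
  open import Algebra.Properties.Ring ring using (-‿involutive; -‿distribˡ-*; -‿distribʳ-*)
  open import Algebra.Properties.Semiring.Sum semiring
    using (sum; sum-cong-≋; sum-replicate-zero; ∑-permute)
  open import Relation.Binary.Reasoning.Setoid setoid

  ∑≡sum : ∀ {n} (f : Fin n → Carrier) → ∑ f ≡ sum f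
  ∑≡sum {zero}  f = refl
  ∑≡sum {suc n} f = cong (f F.zero +_) (∑≡sum (λ i → f (F.suc i)))

  ∑-cong : ∀ {n} {f g : Fin n → Carrier} → (∀ k → f k ≈ g k) → ∑ f ≈ ∑ g
  ∑-cong {f = f} {g} f≈g = begin
    ∑ f    ≡⟨ ∑≡sum f ⟩
    sum f  ≈⟨ sum-cong-≋ f≈g ⟩
    sum g  ≡⟨ ∑≡sum g ⟨
    ∑ g    ∎

  ∑-zero : ∀ {n} (f : Fin n → Carrier) → (∀ k → f k ≈ 0#) → ∑ f ≈ 0#
  ∑-zero {n} f f≈0 = begin
    ∑ f                  ≡⟨ ∑≡sum f ⟩
    sum f                ≈⟨ sum-cong-≋ f≈0 ⟩
    sum (replicate n 0#) ≈⟨ sum-replicate-zero n ⟩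
    0#                   ∎

  ∑-reverse : ∀ {n} (f : Fin n → Carrier) → ∑ (λ k → f (opposite k)) ≈ ∑ f
  ∑-reverse f = begin
    ∑ (λ k → f (opposite k))    ≡⟨ ∑≡sum (λ k → f (opposite k)) ⟩
    sum (λ k → f (opposite k))  ≈⟨ ∑-permute f Perm.reverse ⟨
    sum f                       ≡⟨ ∑≡sum f ⟨
    ∑ f                         ∎

  ∑-move-opposite : ∀ {n} (f g : Fin n → Carrier) →
                    ∑ (λ k → f (opposite k) * g k) ≈ ∑ (λ k → f k * g (opposite k))
  ∑-move-opposite f g = begin
    ∑ (λ k → f (opposite k) * g k)
      ≈⟨ ∑-reverse (λ k → f (opposite k) * g k) ⟨
    ∑ (λ k → f (opposite (opposite k)) * g (opposite k))
      ≈⟨ ∑-cong (λ k → *-congʳ (reflexive (cong f (opposite-involutive k)))) ⟩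
    ∑ (λ k → f k * g (opposite k)) ∎

  ∑-pick : ∀ {n} (f g : Fin n → Carrier) (k₀ : Fin n) →
           g k₀ ≈ 1# → (∀ k → k ≢ k₀ → g k ≈ 0#) → ∑ (λ k → f k * g k) ≈ f k₀
  ∑-pick f g F.zero g₀≈1 g≈0 = begin
    f F.zero * g F.zero + ∑ (λ k → f (F.suc k) * g (F.suc k))
      ≈⟨ +-cong (*-congˡ g₀≈1) (∑-zero _ (λ k → ≈-trans (*-congˡ (g≈0 (F.suc k) λ ())) (zeroʳ _))) ⟩
    f F.zero * 1# + 0#  ≈⟨ +-identityʳ _ ⟩
    f F.zero * 1#       ≈⟨ *-identityʳ _ ⟩
    f F.zero            ∎
  ∑-pick f g (F.suc k₀) gₖ₀≈1 g≈0 = begin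
    f F.zero * g F.zero + ∑ (λ k → f (F.suc k) * g (F.suc k))
      ≈⟨ +-cong (≈-trans (*-congˡ (g≈0 F.zero λ ())) (zeroʳ _))
                (∑-pick (λ k → f (F.suc k)) (λ k → g (F.suc k)) k₀ gₖ₀≈1
                        (λ k k≢k₀ → g≈0 (F.suc k) (λ e → k≢k₀ (suc-injective e)))) ⟩
    0# + f (F.suc k₀)  ≈⟨ +-identityˡ _ ⟩
    f (F.suc k₀)       ∎

  Jex-on : ∀ {n} (j : Fin n) → Jex n (opposite j) j ≈ 1#
  Jex-on {n} j with toℕ (opposite j) N.+ toℕ j N.≟ n ∸ 1
  ... | yes _  = ≈-refl
  ... | no ≢m = contradiction (opposite-sum j) ≢m

  Jex-off : ∀ {n} (k j : Fin n) → k ≢ opposite j → Jex n k j ≈ 0#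
  Jex-off {n} k j k≢op with toℕ k N.+ toℕ j N.≟ n ∸ 1
  ... | yes ≡m = contradiction
        (toℕ-injective (NP.+-cancelʳ-≡ (toℕ j) _ _ (trans ≡m (sym (opposite-sum j))))) k≢op
  ... | no _   = ≈-refl

  ⊗-Jex : ∀ {n} (M : Matrix n) i j → (M ⊗ Jex n) i j ≈ M i (opposite j)
  ⊗-Jex {n} M i j = ∑-pick (M i) (λ k → Jex n k j) (opposite j) (Jex-on j) (λ k → Jex-off k j)

  Jex-⊗ : ∀ {n} (M : Matrix n) i j → (Jex n ⊗ M) i j ≈ M (opposite i) j
  Jex-⊗ {n} M i j = ≈-trans (∑-cong (λ k → *-comm (Jex n i k) (M k j)))
    (∑-pick (λ k → M k j) (Jex n i) (opposite i)
      (subst (λ t → Jex n t (opposite i) ≈ 1#) (opposite-involutive i) (Jex-on (opposite i)))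
      (λ k k≢op → Jex-off i k (λ e → k≢op (sym (trans (cong opposite e) (opposite-involutive k))))))

  Persymmetric : ∀ {n} → Matrix n → Set ℓ
  Persymmetric P = ∀ i j → P (opposite i) (opposite j) ≈ P i j

  persym-shift : ∀ {n} {P : Matrix n} → Persymmetric P → ∀ i j → P (opposite i) j ≈ P i (opposite j)
  persym-shift {P = P} persym i j =
    ≈-trans (reflexive (cong (P (opposite i)) (sym (opposite-involutive j)))) (persym i (opposite j))

  I-persym : ∀ {n} → Persymmetric (I {n})
  I-persym i j with toℕ (opposite i) N.≟ toℕ (opposite j) | toℕ i N.≟ toℕ j
  ... | yes _   | yes _   = ≈-refl
  ... | no _    | no _    = ≈-refl
  ... | yes op≡ | no ≢    = contradiction (cong toℕ (opposite-injective (toℕ-injective op≡))) ≢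
  ... | no op≢  | yes ≡′  = contradiction (cong toℕ (cong opposite (toℕ-injective ≡′))) op≢

  ⊗-persym : ∀ {n} {M N : Matrix n} → Persymmetric M → Persymmetric N → Persymmetric (M ⊗ N)
  ⊗-persym {M = M} {N} persymM persymN i j = begin
    ∑ (λ k → M (opposite i) k * N k (opposite j))
      ≈⟨ ∑-reverse (λ k → M (opposite i) k * N k (opposite j)) ⟨
    ∑ (λ k → M (opposite i) (opposite k) * N (opposite k) (opposite j))
      ≈⟨ ∑-cong (λ k → *-cong (persymM i k) (persymN k j)) ⟩
    ∑ (λ k → M i k * N k j) ∎

  ^-persym : ∀ {n} {P : Matrix n} → Persymmetric P → ∀ s → Persymmetric (P ^ s)
  ^-persym persym zero    = I-persym
  ^-persym persym (suc s) = ⊗-persym persym (^-persym persym s)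

  twisted-power : ∀ {n} {P : Matrix n} → Persymmetric P →
                  ∀ s i j → ((P ⊗ Jex n) ^ s) i j ≈ (P ^ s) i (opposite^ s j)
  twisted-power persym zero    i j = ≈-refl
  twisted-power {n} {P} persym (suc s) i j = begin
    ∑ (λ k → (P ⊗ Jex n) i k * ((P ⊗ Jex n) ^ s) k j)
      ≈⟨ ∑-cong (λ k → *-cong (⊗-Jex P i k) (twisted-power persym s k j)) ⟩
    ∑ (λ k → P i (opposite k) * (P ^ s) k j′)
      ≈⟨ ∑-move-opposite (P i) (λ k → (P ^ s) k j′) ⟩
    ∑ (λ k → P i k * (P ^ s) (opposite k) j′)
      ≈⟨ ∑-cong (λ k → *-congˡ (persym-shift (^-persym persym s) k j′)) ⟩
    ∑ (λ k → P i k * (P ^ s) k (opposite j′)) ∎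
    where
      j′ : Fin n
      j′ = opposite^ s j

  sgn-+ : ∀ x y → sgn (x N.+ y) ≈ sgn x * sgn y
  sgn-+ zero    y = ≈-sym (*-identityˡ _)
  sgn-+ (suc x) y = ≈-trans (-‿cong (sgn-+ x y)) (-‿distribˡ-* _ _)

  sgn-square : ∀ x → sgn x * sgn x ≈ 1#
  sgn-square zero    = *-identityˡ _
  sgn-square (suc x) = begin
    - sgn x * - sgn x    ≈⟨ -‿distribˡ-* _ _ ⟨
    - (sgn x * - sgn x)  ≈⟨ -‿cong (-‿distribʳ-* _ _) ⟨
    - - (sgn x * sgn x)  ≈⟨ -‿involutive _ ⟩
    sgn x * sgn x        ≈⟨ sgn-square x ⟩
    1#                   ∎

  sgn-even : ∀ {k} → 2 ∣ k → sgn k ≈ 1#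
  sgn-even (divides q refl) = sgn-double q
    where
      sgn-double : ∀ q → sgn (q N.* 2) ≈ 1#
      sgn-double zero    = ≈-refl
      sgn-double (suc q) = ≈-trans (-‿involutive _) (sgn-double q)

  sgn-agree : ∀ x y → 2 ∣ x N.+ y → sgn x ≈ sgn y
  sgn-agree x y even = begin
    sgn x                    ≈⟨ *-identityʳ _ ⟨
    sgn x * 1#               ≈⟨ *-congˡ (sgn-square y) ⟨
    sgn x * (sgn y * sgn y)  ≈⟨ *-assoc _ _ _ ⟨
    (sgn x * sgn y) * sgn y  ≈⟨ *-congʳ (≈-trans (≈-sym (sgn-+ x y)) (sgn-even even)) ⟩
    1# * sgn y               ≈⟨ *-identityˡ _ ⟩
    sgn y                    ∎

  sgn-mirror : ∀ {m} x z → 2 ∣ suc m → suc x N.+ z ≡ m → sgn x ≈ sgn z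
  sgn-mirror x z even sum≡m =
    sgn-agree x z (∣m+n∣m⇒∣n (subst (2 ∣_) (sym (cong suc sum≡m)) even) ∣-refl)

  module _ (a b : Carrier) where

    entry : ∀ {x y} → Band x y → Carrier
    entry           (diagonal _)    = a
    entry {x}       (above _)       = sgn x * b
    entry {y = y}   (below _)       = sgn y * b
    entry           (outside _ _ _) = 0#

    Adag-entry : ∀ {n} (i j : Fin n) (β : Band (toℕ i) (toℕ j)) → Adag n a b i j ≈ entry β
    Adag-entry i j (diagonal x≡y) with toℕ i N.≟ toℕ j
    ... | yes _   = ≈-refl
    ... | no x≢y  = contradiction x≡y x≢y
    Adag-entry i j (above y≡1+x) with toℕ i N.≟ toℕ j
    ... | yes x≡y = contradiction (trans x≡y y≡1+x) (NP.m≢1+n+m _ {0})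
    ... | no _ with toℕ j N.≟ suc (toℕ i)
    ...   | yes _    = ≈-refl
    ...   | no y≢1+x = contradiction y≡1+x y≢1+x
    Adag-entry i j (below x≡1+y) with toℕ i N.≟ toℕ j
    ... | yes x≡y = contradiction (trans (sym x≡y) x≡1+y) (NP.m≢1+n+m _ {0})
    ... | no _ with toℕ j N.≟ suc (toℕ i)
    ...   | yes y≡1+x = contradiction (trans y≡1+x (cong suc x≡1+y)) (NP.m≢1+n+m _ {1})
    ...   | no _ with toℕ i N.≟ suc (toℕ j)
    ...     | yes _    = ≈-refl
    ...     | no x≢1+y = contradiction x≡1+y x≢1+y
    Adag-entry i j (outside x≢y y≢1+x x≢1+y) with toℕ i N.≟ toℕ j
    ... | yes x≡y = contradiction x≡y x≢y
    ... | no _ with toℕ j N.≟ suc (toℕ i)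
    ...   | yes y≡1+x = contradiction y≡1+x y≢1+x
    ...   | no _ with toℕ i N.≟ suc (toℕ j)
    ...     | yes x≡1+y = contradiction x≡1+y x≢1+y
    ...     | no _      = ≈-refl

    entry-mirror : ∀ {m x x' y y'} → 2 ∣ suc m → (hx : x N.+ x' ≡ m) (hy : y N.+ y' ≡ m) →
                   (β : Band x y) → entry (mirror-band hx hy β) ≈ entry β
    entry-mirror even hx hy (diagonal _) = ≈-refl
    entry-mirror {x = x} {y' = y'} even hx hy (above y≡1+x) =
      *-congʳ (≈-sym (sgn-mirror x y' even (trans (cong (N._+ y') (sym y≡1+x)) hy)))
    entry-mirror {x' = x'} {y = y} even hx hy (below x≡1+y) =
      *-congʳ (≈-sym (sgn-mirror y x' even (trans (cong (N._+ x') (sym x≡1+y)) hx)))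
    entry-mirror even hx hy (outside _ _ _) = ≈-refl

    Adag-persym : ∀ {n} → 2 ∣ n → Persymmetric (Adag n a b)
    Adag-persym {suc m} even i j = begin
      Adag (suc m) a b (opposite i) (opposite j)  ≈⟨ Adag-entry (opposite i) (opposite j) β ⟩
      entry β                                     ≈⟨ entry-mirror even hx hy β ⟨
      entry (mirror-band hx hy β)                 ≈⟨ Adag-entry i j (mirror-band hx hy β) ⟨
      Adag (suc m) a b i j                        ∎
      where
        β : Band (toℕ (opposite i)) (toℕ (opposite j))
        β = band (toℕ (opposite i)) (toℕ (opposite j))
        hx : toℕ (opposite i) N.+ toℕ i ≡ m
        hx = opposite-sum i
        hy : toℕ (opposite j) N.+ toℕ j ≡ m
        hy = opposite-sum j

lemma5 : ∀ {c ℓ : Level} (R : CommutativeRing c ℓ) →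
    let open CommutativeRing R
        open Mat R
    in ∀ (n : ℕ) → 2 ≤ n → 2 ∣ n → (a b : Carrier) → ¬ (b ≈ 0#) →
       (∀ (k : ℕ) → (Atilde n a b ^ (2 N.* k N.+ 2)) ≋ (Adag n a b ^ (2 N.* k N.+ 2)))
       × (∀ (k : ℕ) → (Atilde n a b ^ (2 N.* k N.+ 1)) ≋ (Jex n ⊗ (Adag n a b ^ (2 N.* k N.+ 1))))
lemma5 R n _ even a b _ = even-powers , odd-powers
  where
    open CommutativeRing R
    open Mat R
    open Persymmetry R
    open import Relation.Binary.Reasoning.Setoid setoid

    A : Matrix n
    A = Adag n a b

    persym : Persymmetric A
    persym = Adag-persym a b even

    even-powers : ∀ k → (Atilde n a b ^ (2 N.* k N.+ 2)) ≋ (A ^ (2 N.* k N.+ 2))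
    even-powers k i j = begin
      (Atilde n a b ^ s) i j     ≈⟨ twisted-power persym s i j ⟩
      (A ^ s) i (opposite^ s j)  ≡⟨ cong ((A ^ s) i) (opposite^-even k j) ⟩
      (A ^ s) i j                ∎
      where
        s : ℕ
        s = 2 N.* k N.+ 2

    odd-powers : ∀ k → (Atilde n a b ^ (2 N.* k N.+ 1)) ≋ (Jex n ⊗ (A ^ (2 N.* k N.+ 1)))
    odd-powers k i j = begin
      (Atilde n a b ^ s) i j     ≈⟨ twisted-power persym s i j ⟩
      (A ^ s) i (opposite^ s j)  ≡⟨ cong ((A ^ s) i) (opposite^-odd k j) ⟩
      (A ^ s) i (opposite j)     ≈⟨ persym-shift (^-persym persym s) i j ⟨
      (A ^ s) (opposite i) j     ≈⟨ Jex-⊗ (A ^ s) i j ⟨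
      (Jex n ⊗ (A ^ s)) i j      ∎
      where
        s : ℕ
        s = 2 N.* k N.+ 1
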